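{- Let $k\in\mathbb{N}$ and $S=\langle 6k+7,6k+11,6k+13\rangle$. Then \[\mathrm{Ap}(S,6k+7)=\{0,\,6k+11,\,6k+13\}\cup\{\,j(6k+13)-4,\ j(6k+13)-2,\ j(6k+13)\mid 2\le j\le 2k+2\,\}\cup\{(2k+3)(6k+13)-2\}.\]
   Context: $\mathbb{N}=\{0,1,2,\dots\}$. For $X\subseteq\mathbb{N}$, $\langle X\rangle$ is the submonoid of $(\mathbb{N},+)$ generated by $X$; here it is a numerical semigroup. For a numerical semigroup $S$ and $n\in S\setminus\{0\}$, the Apéry set is $\mathrm{Ap}(S,n)=\{s\in S\mid s-n\notin S\}$. -}

module Defs where

open import Data.Nat using (ℕ; _+_; _*_; _∸_; _≤_)
open import Data.Product using (Σ; ∃; _×_; _,_)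
open import Data.Sum using (_⊎_)
open import Relation.Nullary using (¬_)
open import Relation.Binary.PropositionalEquality using (_≡_)

InSG3 : ℕ → ℕ → ℕ → ℕ → Set
InSG3 a b c s = ∃ λ x → ∃ λ y → ∃ λ z → s ≡ x * a + y * b + z * c

-- Apéry set Ap(S, n) = { s ∈ S | s - n ∉ S } for S = <a,b,c>, as a predicate.
-- "s - n ∉ S" means: there is no t ∈ S with t + n ≡ s (integer subtraction, S ⊆ ℕ).
InApery3 : ℕ → ℕ → ℕ → ℕ → ℕ → Set
InApery3 a b c n s = InSG3 a b c s × ¬ (∃ λ t → InSG3 a b c t × t + n ≡ s)

-- Since j ≥ 2, j m ≥ 4, so truncated subtraction ∸ agrees with integer subtraction.
InExplicit : ℕ → ℕ → Set
InExplicit k s =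
  s ≡ 0 ⊎ s ≡ 6 * k + 11 ⊎ s ≡ 6 * k + 13
  ⊎ (∃ λ j → 2 ≤ j × j ≤ 2 * k + 2 ×
       (s ≡ j * (6 * k + 13) ∸ 4 ⊎ s ≡ j * (6 * k + 13) ∸ 2 ⊎ s ≡ j * (6 * k + 13)))
  ⊎ s ≡ (2 * k + 3) * (6 * k + 13) ∸ 2

{-# OPTIONS --safe #-}
module Submission where

-- Put a = 6k+7, b = a+4 = 6k+11 and c = a+6 = 6k+13.  An element x·a + y·b + z·c
-- of S equals n·a + r with n = x+y+z and weight r = 4y+6z ≤ 6n.  Take s = y·b + z·c
-- with y ≤ 2, so that its weight w = 4y+6z satisfies 6(y+z) ≤ w + 4, and suppose
-- s = a + (n·a + r).  If y+z > n then r ≥ w, contradicting both bounds.  Otherwise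
-- w = r + m·a with m ≥ 1: m = 1 is impossible since a is odd and weights are even,
-- and m ≥ 2 is impossible when w < 2a, or when w = 2a+2 (it would force r = 2).
-- Conversely, every other representation acquires a summand a through one of
-- 3b = a + 2c,  2b + (2k+1)c = (2k+5)a,  (2k+3)c = (2k+4)a + b.

open import Defs
open import Data.Nat using (ℕ; zero; suc; _+_; _*_; _∸_; _≤_; _<_; z≤n; s≤s)
open import Data.Nat.Properties
open import Data.Nat.Divisibility using (_∣_; divides; ∣m+n∣m⇒∣n; n∣m*n; ∣1⇒≡1)
open import Data.Nat.Tactic.RingSolver using (solve; solve-∀)
open import Data.List using (_∷_; [])
open import Data.Product using (∃; ∃₂; _×_; _,_)
open import Data.Sum using (_⊎_; inj₁; inj₂)
import Data.Sum as Sum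
open import Data.Empty using (⊥; ⊥-elim)
open import Relation.Nullary using (¬_; contradiction)
open import Relation.Binary.PropositionalEquality
open import Function.Base using (_∘_)
open import Function.Bundles using (_⇔_; mk⇔)
open import Function.Construct.Composition using (_⇔-∘_)

split-at : ∀ n z → z ≤ n ⊎ ∃ λ o → suc n + o ≡ z
split-at n z = Sum.map₂ (λ n<z → m≤n⇒∃[o]m+o≡n n<z) (≤-<-connex z n)

∸-by : ∀ {m n} o → n ≡ m + o → n ∸ o ≡ m
∸-by {m} o refl = m+n∸n≡m m o

expand-combination : ∀ a x y z →
  x * a + y * (a + 4) + z * (a + 6) ≡ (x + y + z) * a + (4 * y + 6 * z)
expand-combination = solve-∀

weight-even : ∀ y z → 2 ∣ 4 * y + 6 * z
weight-even y z = divides (2 * y + 3 * z) (solve (y ∷ z ∷ []))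

weight≢2 : ∀ y z → 4 * y + 6 * z ≢ 2
weight≢2 zero    zero    ()
weight≢2 zero    (suc z) eq with trans (sym (*-suc 6 z)) eq
... | ()
weight≢2 (suc y) z       eq with trans (cong (_+ 6 * z) (sym (*-suc 4 y))) eq
... | ()

weight≤ : ∀ x y z → 4 * y + 6 * z ≤ 6 * (x + y + z)
weight≤ x y z = begin
  4 * y + 6 * z           ≤⟨ +-monoˡ-≤ (6 * z) (*-monoˡ-≤ y (m≤m+n 4 2)) ⟩
  6 * y + 6 * z           ≤⟨ m≤n+m _ (6 * x) ⟩
  6 * x + (6 * y + 6 * z) ≡⟨ solve (x ∷ y ∷ z ∷ []) ⟩
  6 * (x + y + z)         ∎
  where open ≤-Reasoning

weight≥ : ∀ {y} z → y ≤ 2 → 6 * (y + z) ≤ 4 + (4 * y + 6 * z)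
weight≥ {y} z y≤2 = begin
  6 * (y + z)             ≡⟨ solve (y ∷ z ∷ []) ⟩
  2 * y + (4 * y + 6 * z) ≤⟨ +-monoˡ-≤ _ (*-monoʳ-≤ 2 y≤2) ⟩
  4 + (4 * y + 6 * z)     ∎
  where open ≤-Reasoning

not-shifted-from-above : ∀ {a d e n r} → 6 * (suc n + d) ≤ 4 + e → r ≤ 6 * n →
  (suc n + d) * a + e ≢ n * a + r + a
not-shifted-from-above {a} {d} {e} {n} {r} heavy r≤ eq = <-irrefl refl (begin-strict
  4 + 6 * n       <⟨ +-monoˡ-< (6 * n) (m≤m+n 5 1) ⟩
  6 + 6 * n       ≡⟨ sym (*-suc 6 n) ⟩
  6 * suc n       ≤⟨ *-monoʳ-≤ 6 (m≤m+n (suc n) d) ⟩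
  6 * (suc n + d) ≤⟨ heavy ⟩
  4 + e           ≤⟨ +-monoʳ-≤ 4 (subst (e ≤_) da+e≡r (m≤n+m e (d * a))) ⟩
  4 + r           ≤⟨ +-monoʳ-≤ 4 r≤ ⟩
  4 + 6 * n       ∎)
  where
  open ≤-Reasoning
  da+e≡r : d * a + e ≡ r
  da+e≡r = +-cancelˡ-≡ (n * a + a) _ _ (begin-equality
    n * a + a + (d * a + e) ≡⟨ solve (a ∷ d ∷ e ∷ n ∷ []) ⟩
    (suc n + d) * a + e     ≡⟨ eq ⟩
    n * a + r + a           ≡⟨ solve (a ∷ n ∷ r ∷ []) ⟩
    n * a + a + r           ∎)

module _ {a : ℕ} (a-odd : ¬ 2 ∣ a) (2<a : 2 < a) where

  not-shifted-from-below : ∀ {W d e r} → e < 2 * a ⊎ e ≡ 2 * a + 2 →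
    2 ∣ e → 2 ∣ r → r ≢ 2 → W * a + e ≢ (W + d) * a + r + a
  not-shifted-from-below {W} {d} {e} {r} e-light 2∣e 2∣r r≢2 eq = excess d e≡a+excess
    where
    e≡a+excess : e ≡ a + (d * a + r)
    e≡a+excess = +-cancelˡ-≡ (W * a) _ _ (trans eq (solve (a ∷ W ∷ d ∷ r ∷ [])))

    excess : ∀ d → e ≡ a + (d * a + r) → ⊥
    excess zero e≡a+r =
      a-odd (∣m+n∣m⇒∣n (subst (2 ∣_) (trans e≡a+r (+-comm a r)) 2∣e) 2∣r)
    excess (suc d) e≡ = Sum.[ e≮2a , rest≢2 d ∘ cancel-2a ] e-light
      where
      e≡2a+rest : e ≡ 2 * a + (d * a + r)
      e≡2a+rest = trans e≡ (solve (a ∷ d ∷ r ∷ []))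
      e≮2a : ¬ e < 2 * a
      e≮2a e<2a = <⇒≱ e<2a (subst (2 * a ≤_) (sym e≡2a+rest) (m≤m+n (2 * a) (d * a + r)))
      cancel-2a : e ≡ 2 * a + 2 → d * a + r ≡ 2
      cancel-2a e≡2a+2 = +-cancelˡ-≡ (2 * a) _ _ (trans (sym e≡2a+rest) e≡2a+2)
      rest≢2 : ∀ d → d * a + r ≢ 2
      rest≢2 zero    = r≢2
      rest≢2 (suc d) rest≡2 =
        <⇒≱ 2<a (≤-trans (≤-trans (m≤m+n a (d * a)) (m≤m+n _ r)) (≤-reflexive rest≡2))

  not-shifted : ∀ {W e n r} → 6 * W ≤ 4 + e → e < 2 * a ⊎ e ≡ 2 * a + 2 → 2 ∣ e →
    r ≤ 6 * n → 2 ∣ r → r ≢ 2 → W * a + e ≢ n * a + r + a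
  not-shifted {W} {e} {n} {r} W≤ e-light 2∣e r≤ 2∣r r≢2 with ≤-<-connex W n
  ... | inj₁ W≤n with m≤n⇒∃[o]m+o≡n W≤n
  ...   | d , refl = not-shifted-from-below {W} {d} e-light 2∣e 2∣r r≢2
  not-shifted {W} {e} {n} {r} W≤ e-light 2∣e r≤ 2∣r r≢2 | inj₂ n<W with m≤n⇒∃[o]m+o≡n n<W
  ...   | d , refl = not-shifted-from-above {a} {d} {e} {n} W≤ r≤

  apery-of-light : ∀ {b c} → b ≡ a + 4 → c ≡ a + 6 → ∀ {y z} → y ≤ 2 →
    4 * y + 6 * z < 2 * a ⊎ 4 * y + 6 * z ≡ 2 * a + 2 →
    InApery3 a b c a (y * b + z * c)
  apery-of-light refl refl {y} {z} y≤2 light = (0 , y , z , refl) , no-shift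
    where
    no-shift : ¬ ∃ λ t → InSG3 a (a + 4) (a + 6) t × t + a ≡ y * (a + 4) + z * (a + 6)
    no-shift (_ , (x′ , y′ , z′ , refl) , t+a≡s) =
      not-shifted {y + z} {4 * y + 6 * z} {x′ + y′ + z′} (weight≥ z y≤2) light (weight-even y z)
                  (weight≤ x′ y′ z′) (weight-even y′ z′) (weight≢2 y′ z′) (begin
        (y + z) * a + (4 * y + 6 * z)              ≡⟨ sym (expand-combination a 0 y z) ⟩
        y * (a + 4) + z * (a + 6)                  ≡⟨ sym t+a≡s ⟩
        x′ * a + y′ * (a + 4) + z′ * (a + 6) + a   ≡⟨ cong (_+ a) (expand-combination a x′ y′ z′) ⟩
        (x′ + y′ + z′) * a + (4 * y′ + 6 * z′) + a ∎)
      where open ≡-Reasoning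

6k+7-odd : ∀ k → ¬ 2 ∣ 6 * k + 7
6k+7-odd k 2∣6k+7 = contradiction (∣1⇒≡1 2∣1) λ ()
  where
  6k+7≡ : 6 * k + 7 ≡ (3 * k + 3) * 2 + 1
  6k+7≡ = solve (k ∷ [])
  2∣1 : 2 ∣ 1
  2∣1 = ∣m+n∣m⇒∣n (subst (2 ∣_) 6k+7≡ 2∣6k+7) (n∣m*n (3 * k + 3))

2<6k+7 : ∀ k → 2 < 6 * k + 7
2<6k+7 k = ≤-trans (m≤m+n 3 4) (m≤n+m 7 (6 * k))

1≤2k+2 : ∀ k → 1 ≤ 2 * k + 2
1≤2k+2 k = ≤-trans (s≤s z≤n) (m≤n+m 2 (2 * k))

data ApéryExponents (k : ℕ) : ℕ → ℕ → Set where
  bounded : ∀ {y z} → y ≤ 2 → y + z ≤ 2 * k + 2 → ApéryExponents k y z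
  top     : ApéryExponents k 1 (2 * k + 2)

HasApéryExponents : ℕ → ℕ → Set
HasApéryExponents k s =
  ∃₂ λ y z → ApéryExponents k y z × s ≡ y * (6 * k + 11) + z * (6 * k + 13)

exponents-light : ∀ {k y z} → ApéryExponents k y z →
  4 * y + 6 * z < 2 * (6 * k + 7) ⊎ 4 * y + 6 * z ≡ 2 * (6 * k + 7) + 2
exponents-light {k} (bounded {y} {z} _ y+z≤) = inj₁ (begin-strict
  4 * y + 6 * z       ≤⟨ weight≤ 0 y z ⟩
  6 * (y + z)         ≤⟨ *-monoʳ-≤ 6 y+z≤ ⟩
  6 * (2 * k + 2)     <⟨ m<m+n _ (s≤s z≤n) ⟩
  6 * (2 * k + 2) + 2 ≡⟨ solve (k ∷ []) ⟩
  2 * (6 * k + 7)     ∎)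
  where open ≤-Reasoning
exponents-light {k} top = inj₂ (solve (k ∷ []))

exponents-y≤2 : ∀ {k y z} → ApéryExponents k y z → y ≤ 2
exponents-y≤2 (bounded y≤2 _) = y≤2
exponents-y≤2 top             = s≤s z≤n

exponents⇒apery : ∀ k {s} → HasApéryExponents k s →
  InApery3 (6 * k + 7) (6 * k + 11) (6 * k + 13) (6 * k + 7) s
exponents⇒apery k (y , z , e , refl) =
  apery-of-light (6k+7-odd k) (2<6k+7 k) (sym (+-assoc (6 * k) 7 4)) (sym (+-assoc (6 * k) 7 6))
                 {y} {z} (exponents-y≤2 e) (exponents-light e)

-- The relations are stated as t + a = s, with t and s combinations of a, b, c,
-- which is the form that exhibits s - a ∈ S.
+a-increments-x : ∀ k x y z →
  x * (6 * k + 7) + y * (6 * k + 11) + z * (6 * k + 13) + (6 * k + 7)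
  ≡ suc x * (6 * k + 7) + y * (6 * k + 11) + z * (6 * k + 13)
+a-increments-x = solve-∀

3b≡a+2c : ∀ k y z →
  y * (6 * k + 11) + (2 + z) * (6 * k + 13) + (6 * k + 7)
  ≡ (3 + y) * (6 * k + 11) + z * (6 * k + 13)
3b≡a+2c = solve-∀

2b+[2k+1]c≡[2k+5]a : ∀ k z →
  (2 * k + 4) * (6 * k + 7) + 0 * (6 * k + 11) + z * (6 * k + 13) + (6 * k + 7)
  ≡ 2 * (6 * k + 11) + (suc (2 * k) + z) * (6 * k + 13)
2b+[2k+1]c≡[2k+5]a = solve-∀

[2k+3]c≡[2k+4]a+b : ∀ k y z →
  (2 * k + 3) * (6 * k + 7) + suc y * (6 * k + 11) + z * (6 * k + 13) + (6 * k + 7)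
  ≡ y * (6 * k + 11) + (suc (2 * k + 2) + z) * (6 * k + 13)
[2k+3]c≡[2k+4]a+b = solve-∀

apery⇒exponents : ∀ k {s} → InApery3 (6 * k + 7) (6 * k + 11) (6 * k + 13) (6 * k + 7) s →
  HasApéryExponents k s
apery⇒exponents k {s} ((x , y , z , s≡) , no-shift) = reduce x y z s≡
  where
  shifted : ∀ x y z →
    x * (6 * k + 7) + y * (6 * k + 11) + z * (6 * k + 13) + (6 * k + 7) ≡ s → ⊥
  shifted x y z eq = no-shift (_ , (x , y , z , refl) , eq)

  reduce : ∀ x y z → s ≡ x * (6 * k + 7) + y * (6 * k + 11) + z * (6 * k + 13) →
    HasApéryExponents k s
  reduce (suc x) y z s≡ = ⊥-elim (shifted x y z (trans (+a-increments-x k x y z) (sym s≡)))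
  reduce zero (suc (suc (suc y))) z s≡ =
    ⊥-elim (shifted 0 y (2 + z) (trans (3b≡a+2c k y z) (sym s≡)))
  reduce zero 0 z s≡ with split-at (2 * k + 2) z
  ... | inj₁ z≤       = 0 , z , bounded z≤n z≤ , s≡
  ... | inj₂ (o , refl) =
    ⊥-elim (shifted (2 * k + 3) 1 o (trans ([2k+3]c≡[2k+4]a+b k 0 o) (sym s≡)))
  reduce zero 1 z s≡ with split-at (2 * k + 2) z
  ... | inj₂ (o , refl) =
    ⊥-elim (shifted (2 * k + 3) 2 o (trans ([2k+3]c≡[2k+4]a+b k 1 o) (sym s≡)))
  ... | inj₁ z≤ with m≤n⇒m<n∨m≡n z≤
  ...   | inj₁ z<    = 1 , z , bounded (s≤s z≤n) z< , s≡
  ...   | inj₂ refl  = 1 , z , top , s≡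
  reduce zero 2 z s≡ with split-at (2 * k) z
  ... | inj₁ z≤       =
    2 , z , bounded ≤-refl (subst (2 + z ≤_) (+-comm 2 (2 * k)) (s≤s (s≤s z≤))) , s≡
  ... | inj₂ (o , refl) =
    ⊥-elim (shifted (2 * k + 4) 0 o (trans (2b+[2k+1]c≡[2k+5]a k o) (sym s≡)))

c≡b+2 : ∀ k j → suc j * (6 * k + 13) ≡ 1 * (6 * k + 11) + j * (6 * k + 13) + 2
c≡b+2 = solve-∀

2c≡2b+4 : ∀ k j → (2 + j) * (6 * k + 13) ≡ 2 * (6 * k + 11) + j * (6 * k + 13) + 4
2c≡2b+4 = solve-∀

[2k+3]c≡b+[2k+2]c+2 : ∀ k →
  (2 * k + 3) * (6 * k + 13) ≡ 1 * (6 * k + 11) + (2 * k + 2) * (6 * k + 13) + 2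
[2k+3]c≡b+[2k+2]c+2 k = trans (cong (_* (6 * k + 13)) (+-suc (2 * k) 2)) (c≡b+2 k (2 * k + 2))

1b+0c≡b : ∀ k → 1 * (6 * k + 11) + 0 * (6 * k + 13) ≡ 6 * k + 11
1b+0c≡b k = trans (+-identityʳ _) (+-identityʳ _)

exponents⇒explicit : ∀ k {s} → HasApéryExponents k s → InExplicit k s
exponents⇒explicit k (_ , _ , e , s≡) = go e s≡
  where
  go : ∀ {y z s} → ApéryExponents k y z → s ≡ y * (6 * k + 11) + z * (6 * k + 13) →
    InExplicit k s
  go top s≡ = inj₂ (inj₂ (inj₂ (inj₂ (trans s≡ (sym (∸-by 2 ([2k+3]c≡b+[2k+2]c+2 k)))))))
  go (bounded {0} {0} _ _) s≡ = inj₁ s≡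
  go (bounded {0} {1} _ _) s≡ = inj₂ (inj₂ (inj₁ (trans s≡ (+-identityʳ _))))
  go (bounded {0} {suc (suc i)} _ j≤) s≡ =
    inj₂ (inj₂ (inj₂ (inj₁ (2 + i , s≤s (s≤s z≤n) , j≤ , inj₂ (inj₂ s≡)))))
  go (bounded {1} {0} _ _) s≡ = inj₂ (inj₁ (trans s≡ (1b+0c≡b k)))
  go (bounded {1} {suc i} _ j≤) s≡ =
    inj₂ (inj₂ (inj₂ (inj₁ (2 + i , s≤s (s≤s z≤n) , j≤ ,
      inj₂ (inj₁ (trans s≡ (sym (∸-by 2 (c≡b+2 k (suc i))))))))))
  go (bounded {2} {i} _ j≤) s≡ =
    inj₂ (inj₂ (inj₂ (inj₁ (2 + i , s≤s (s≤s z≤n) , j≤ ,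
      inj₁ (trans s≡ (sym (∸-by 4 (2c≡2b+4 k i))))))))
  go (bounded {suc (suc (suc _))} (s≤s (s≤s ())) _) _

explicit⇒exponents : ∀ k {s} → InExplicit k s → HasApéryExponents k s
explicit⇒exponents k (inj₁ s≡0) = 0 , 0 , bounded z≤n z≤n , s≡0
explicit⇒exponents k (inj₂ (inj₁ s≡b)) =
  1 , 0 , bounded (s≤s z≤n) (1≤2k+2 k) , trans s≡b (sym (1b+0c≡b k))
explicit⇒exponents k (inj₂ (inj₂ (inj₁ s≡c))) =
  0 , 1 , bounded z≤n (1≤2k+2 k) , trans s≡c (sym (+-identityʳ _))
explicit⇒exponents k (inj₂ (inj₂ (inj₂ (inj₁ (1 , s≤s () , _)))))
explicit⇒exponents k (inj₂ (inj₂ (inj₂ (inj₁ (suc (suc i) , s≤s (s≤s z≤n) , j≤ , inj₁ s≡))))) =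
  2 , i , bounded ≤-refl j≤ , trans s≡ (∸-by 4 (2c≡2b+4 k i))
explicit⇒exponents k (inj₂ (inj₂ (inj₂ (inj₁ (suc (suc i) , s≤s (s≤s z≤n) , j≤ , inj₂ (inj₁ s≡)))))) =
  1 , suc i , bounded (s≤s z≤n) j≤ , trans s≡ (∸-by 2 (c≡b+2 k (suc i)))
explicit⇒exponents k (inj₂ (inj₂ (inj₂ (inj₁ (j , _ , j≤ , inj₂ (inj₂ s≡)))))) =
  0 , j , bounded z≤n j≤ , s≡
explicit⇒exponents k (inj₂ (inj₂ (inj₂ (inj₂ s≡)))) =
  1 , 2 * k + 2 , top , trans s≡ (∸-by 2 ([2k+3]c≡b+[2k+2]c+2 k))

corollary15 : (k s : ℕ) →
    InApery3 (6 * k + 7) (6 * k + 11) (6 * k + 13) (6 * k + 7) s ⇔ InExplicit k s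
corollary15 k s =
  mk⇔ (exponents⇒explicit k) (explicit⇒exponents k)
  ⇔-∘ mk⇔ (apery⇒exponents k) (exponents⇒apery k)
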